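{- Let $\oplus_f$ be any binary operation assigning to each pair of programs $(P_1,P_2)$ a program $P_1\oplus_f P_2$. Then the following are equivalent: (BK-6) for all programs $P,P_1,P_2$: if $P_1\equiv_{N_2}P_2$ then $P\oplus_f P_1$ and $P\oplus_f P_2$ have the same answer sets; (BK-0) for all programs $P_1,P_2,R$: if $P_2\vdash_{N_2}R$ then $P_1\oplus_f P_2$ and $P_1\oplus_f(P_2\cup R)$ have the same answer sets.
   Context: Formulas are built from atoms using $\wedge,\vee,\rightarrow,\bot$ and strong negation $\sim$; $\lnot F$ abbreviates $F\rightarrow\bot$. $\mathrm{N}_2$ is intuitionistic propositional logic extended with Nelson's strong-negation axioms ($\sim(\alpha\rightarrow\beta)\leftrightarrow\alpha\wedge\sim\beta$, $\sim(\alpha\wedge\beta)\leftrightarrow\sim\alpha\vee\sim\beta$, $\sim(\alpha\vee\beta)\leftrightarrow\sim\alpha\wedge\sim\beta$, $\alpha\leftrightarrow\sim\sim\alpha$, $\sim\lnot\alpha\leftrightarrow\alpha$, $\sim a\rightarrow\lnot a$ for atoms $a$) and the schema $\alpha\vee(\alpha\rightarrow\beta)\vee\lnot\beta$. For sets of formulas, $T\vdash_{N_2}R$ means $T$ derives every formula of $R$ in $\mathrm{N}_2$, and $T\equiv_{N_2}T'$ means $T\vdash_{N_2}T'$ and $T'\vdash_{N_2}T$. A program is a finite set of formulas $G\rightarrow l$ with $l$ a literal ($a$ or $\sim a$) and $G$ built from literals, $\top,\bot$ by $\wedge,\vee,\lnot$. A consistent set $M$ of literals over the atoms $\mathcal{A}$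 of a program $P$ is an answer set of $P$ iff $P\cup\{\lnot l: l\in Lit_{\mathcal{A}}\setminus M\}\cup\{\lnot\lnot l: l\in M\}$ is $\mathrm{N}_2$-consistent and $\mathrm{N}_2$-derives every literal of $M$. -}

module Defs where

open import Data.Nat using (ℕ)
open import Data.List using (List; _++_)
open import Data.List.Membership.Propositional using (_∈_)
open import Data.Product using (Σ; ∃; _×_; _,_)
open import Data.Sum using (_⊎_)
open import Relation.Nullary using (¬_)
open import Relation.Binary.PropositionalEquality using (_≡_)

Atom : Set
Atom = ℕ

infixr 6 _∧_
infixr 5 _∨_
infixr 4 _⇒_
data Formula : Set where
  at   : Atom → Formula
  _∧_  : Formula → Formula → Formula
  _∨_  : Formula → Formula → Formula
  _⇒_  : Formula → Formula → Formula
  ⊥f   : Formula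
  ∼_   : Formula → Formula

¬f_ : Formula → Formula
¬f F = F ⇒ ⊥f

⊤f : Formula
⊤f = ⊥f ⇒ ⊥f

_⇔f_ : Formula → Formula → Formula
A ⇔f B = (A ⇒ B) ∧ (B ⇒ A)

Theory : Set₁
Theory = Formula → Set

-- Axioms of N₂: intuitionistic propositional logic (Hilbert style),
-- Nelson's strong negation axioms, and α ∨ (α → β) ∨ ¬β.
data Axiom : Formula → Set where
  ax-K   : ∀ A B → Axiom (A ⇒ B ⇒ A)
  ax-S   : ∀ A B C → Axiom ((A ⇒ B ⇒ C) ⇒ (A ⇒ B) ⇒ A ⇒ C)
  ax-∧I  : ∀ A B → Axiom (A ⇒ B ⇒ A ∧ B)
  ax-∧E₁ : ∀ A B → Axiom (A ∧ B ⇒ A)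
  ax-∧E₂ : ∀ A B → Axiom (A ∧ B ⇒ B)
  ax-∨I₁ : ∀ A B → Axiom (A ⇒ A ∨ B)
  ax-∨I₂ : ∀ A B → Axiom (B ⇒ A ∨ B)
  ax-∨E  : ∀ A B C → Axiom ((A ⇒ C) ⇒ (B ⇒ C) ⇒ A ∨ B ⇒ C)
  ax-⊥E  : ∀ A → Axiom (⊥f ⇒ A)
  ax-∼⇒  : ∀ A B → Axiom ((∼ (A ⇒ B)) ⇔f (A ∧ ∼ B))
  ax-∼∧  : ∀ A B → Axiom ((∼ (A ∧ B)) ⇔f (∼ A ∨ ∼ B))
  ax-∼∨  : ∀ A B → Axiom ((∼ (A ∨ B)) ⇔f (∼ A ∧ ∼ B))
  ax-∼∼  : ∀ A → Axiom (A ⇔f (∼ (∼ A)))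
  ax-∼¬  : ∀ A → Axiom ((∼ (¬f A)) ⇔f A)
  ax-∼at : ∀ a → Axiom (∼ (at a) ⇒ ¬f (at a))
  ax-N₂  : ∀ A B → Axiom (A ∨ (A ⇒ B) ∨ ¬f B)

infix 2 _⊢_
data _⊢_ (T : Theory) : Formula → Set where
  hyp : ∀ {F} → T F → T ⊢ F
  axm : ∀ {F} → Axiom F → T ⊢ F
  mp  : ∀ {A B} → T ⊢ A ⇒ B → T ⊢ A → T ⊢ B

data Lit : Set where
  pos : Atom → Lit
  neg : Atom → Lit

litF : Lit → Formula
litF (pos a) = at a
litF (neg a) = ∼ (at a)

litAtom : Lit → Atom
litAtom (pos a) = a
litAtom (neg a) = a

data Body : Set where
  bLit : Lit → Body
  b⊤   : Body
  b⊥   : Body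
  b∧   : Body → Body → Body
  b∨   : Body → Body → Body
  b¬   : Body → Body

bodyF : Body → Formula
bodyF (bLit l) = litF l
bodyF b⊤ = ⊤f
bodyF b⊥ = ⊥f
bodyF (b∧ G H) = bodyF G ∧ bodyF H
bodyF (b∨ G H) = bodyF G ∨ bodyF H
bodyF (b¬ G) = ¬f (bodyF G)

record Rule : Set where
  constructor _⟶_
  field
    body : Body
    head : Lit
open Rule public

ruleF : Rule → Formula
ruleF r = bodyF (body r) ⇒ litF (head r)

-- Programs: finite sets of rules, represented as lists
-- (set semantics: only membership matters, see ≈P and RespectsSetEq)
Program : Set
Program = List Rule

progT : Program → Theory
progT P F = Σ Rule λ r → r ∈ P × ruleF r ≡ F

_⊢P_ : Theory → Program → Set
T ⊢P R = ∀ r → r ∈ R → T ⊢ ruleF r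

_≡N₂_ : Program → Program → Set
P₁ ≡N₂ P₂ = (progT P₁ ⊢P P₂) × (progT P₂ ⊢P P₁)

data OccB (a : Atom) : Body → Set where
  o-lit : ∀ {l} → litAtom l ≡ a → OccB a (bLit l)
  o-∧₁  : ∀ {G H} → OccB a G → OccB a (b∧ G H)
  o-∧₂  : ∀ {G H} → OccB a H → OccB a (b∧ G H)
  o-∨₁  : ∀ {G H} → OccB a G → OccB a (b∨ G H)
  o-∨₂  : ∀ {G H} → OccB a H → OccB a (b∨ G H)
  o-¬   : ∀ {G} → OccB a G → OccB a (b¬ G)

OccR : Atom → Rule → Set
OccR a r = OccB a (body r) ⊎ litAtom (head r) ≡ a

AtomOf : Program → Atom → Set
AtomOf P a = Σ Rule λ r → r ∈ P × OccR a r

LitOf : Program → Lit → Set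
LitOf P l = AtomOf P (litAtom l)

LitSet : Set₁
LitSet = Lit → Set

asTheory : Program → LitSet → Theory
asTheory P M F =
  progT P F
  ⊎ (Σ Lit λ l → LitOf P l × ¬ M l × ¬f (litF l) ≡ F)
  ⊎ (Σ Lit λ l → M l × ¬f (¬f (litF l)) ≡ F)

record AnswerSet (P : Program) (M : LitSet) : Set where
  field
    overAtoms  : ∀ l → M l → LitOf P l
    consistent : ∀ a → M (pos a) → ¬ M (neg a)
    n2consist  : ¬ (asTheory P M ⊢ ⊥f)
    derives    : ∀ l → M l → asTheory P M ⊢ litF l

SameAnswerSets : Program → Program → Set₁
SameAnswerSets P Q = ∀ (M : LitSet) → (AnswerSet P M → AnswerSet Q M) × (AnswerSet Q M → AnswerSet P M)

_≈P_ : Program → Program → Set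
P ≈P Q = ∀ r → (r ∈ P → r ∈ Q) × (r ∈ Q → r ∈ P)

RespectsSetEq : (Program → Program → Program) → Set
RespectsSetEq _⊕_ = ∀ P P' Q Q' → P ≈P P' → Q ≈P Q' → (P ⊕ Q) ≈P (P' ⊕ Q')

BK6 : (Program → Program → Program) → Set₁
BK6 _⊕_ = ∀ P P₁ P₂ → P₁ ≡N₂ P₂ → SameAnswerSets (P ⊕ P₁) (P ⊕ P₂)

BK0 : (Program → Program → Program) → Set₁
BK0 _⊕_ = ∀ P₁ P₂ R → progT P₂ ⊢P R → SameAnswerSets (P₁ ⊕ P₂) (P₁ ⊕ (P₂ ++ R))

{-# OPTIONS --safe #-}
module Submission where

-- BK-6 ⇒ BK-0: if P₂ ⊢ R then P₂ and P₂ ∪ R are N₂-equivalent.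
-- BK-0 ⇒ BK-6: if P₁ ≡ P₂, then P₁ ∪ P₂ arises from P₁ by adding consequences of P₁,
-- and also, as the same set P₂ ∪ P₁, from P₂ by adding consequences of P₂.
-- Since ⊕ respects set equality and answer sets depend only on the set of rules,
-- P ⊕ P₁ and P ⊕ P₂ have the same answer sets as P ⊕ (P₁ ∪ P₂).

open import Defs
open import Data.Product using (_×_; _,_; proj₁; proj₂)
open import Data.Sum using (inj₁; inj₂)
open import Data.List using (_++_)
open import Data.List.Membership.Propositional.Properties using (∈-++⁺ˡ; ∈-++⁻)
open import Data.List.Relation.Unary.Any.Properties using (++-comm)
open import Relation.Binary.PropositionalEquality using (refl)

⊢-mono : ∀ {T T′ : Theory} → (∀ {F} → T F → T′ F) → ∀ {F} → T ⊢ F → T′ ⊢ F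
⊢-mono T⊆T′ (hyp F∈T) = hyp (T⊆T′ F∈T)
⊢-mono T⊆T′ (axm ax)  = axm ax
⊢-mono T⊆T′ (mp d e)  = mp (⊢-mono T⊆T′ d) (⊢-mono T⊆T′ e)

≈P-sym : ∀ {P Q} → P ≈P Q → Q ≈P P
≈P-sym P≈Q r = proj₂ (P≈Q r) , proj₁ (P≈Q r)

≈P-refl : ∀ P → P ≈P P
≈P-refl P r = (λ r∈P → r∈P) , (λ r∈P → r∈P)

++-comm-≈P : ∀ P Q → (P ++ Q) ≈P (Q ++ P)
++-comm-≈P P Q r = ++-comm P Q , ++-comm Q P

asTheory-resp-≈P : ∀ {P Q} M → P ≈P Q → ∀ {F} → asTheory P M F → asTheory Q M F
asTheory-resp-≈P M P≈Q (inj₁ (r , r∈P , refl)) =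
  inj₁ (r , proj₁ (P≈Q r) r∈P , refl)
asTheory-resp-≈P M P≈Q (inj₂ (inj₁ (l , (r , r∈P , occ) , l∉M , refl))) =
  inj₂ (inj₁ (l , (r , proj₁ (P≈Q r) r∈P , occ) , l∉M , refl))
asTheory-resp-≈P M P≈Q (inj₂ (inj₂ ¬¬l)) = inj₂ (inj₂ ¬¬l)

AnswerSet-resp-≈P : ∀ {P Q M} → P ≈P Q → AnswerSet P M → AnswerSet Q M
AnswerSet-resp-≈P {M = M} P≈Q A = record
  { overAtoms  = λ l l∈M → let r , r∈P , occ = overAtoms l l∈M in r , proj₁ (P≈Q r) r∈P , occ
  ; consistent = consistent
  ; n2consist  = λ ⊢⊥ → n2consist (⊢-mono (asTheory-resp-≈P M (≈P-sym P≈Q)) ⊢⊥)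
  ; derives    = λ l l∈M → ⊢-mono (asTheory-resp-≈P M P≈Q) (derives l l∈M)
  }
  where open AnswerSet A

≈P⇒SameAnswerSets : ∀ {P Q} → P ≈P Q → SameAnswerSets P Q
≈P⇒SameAnswerSets P≈Q M = AnswerSet-resp-≈P P≈Q , AnswerSet-resp-≈P (≈P-sym P≈Q)

SameAnswerSets-sym : ∀ {P Q} → SameAnswerSets P Q → SameAnswerSets Q P
SameAnswerSets-sym P~Q M = proj₂ (P~Q M) , proj₁ (P~Q M)

SameAnswerSets-trans : ∀ {P Q S} → SameAnswerSets P Q → SameAnswerSets Q S → SameAnswerSets P S
SameAnswerSets-trans P~Q Q~S M =
  (λ A → proj₁ (Q~S M) (proj₁ (P~Q M) A)) , (λ A → proj₂ (P~Q M) (proj₂ (Q~S M) A))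

⊢P-++⁺ˡ : ∀ P R → progT (P ++ R) ⊢P P
⊢P-++⁺ˡ P R r r∈P = hyp (r , ∈-++⁺ˡ r∈P , refl)

⊢P⇒≡N₂-++ : ∀ P R → progT P ⊢P R → P ≡N₂ (P ++ R)
⊢P⇒≡N₂-++ P R P⊢R = P⊢P++R , ⊢P-++⁺ˡ P R
  where
  P⊢P++R : progT P ⊢P (P ++ R)
  P⊢P++R r r∈P++R with ∈-++⁻ P r∈P++R
  ... | inj₁ r∈P = hyp (r , r∈P , refl)
  ... | inj₂ r∈R = P⊢R r r∈R

BK6⇒BK0 : ∀ _⊕_ → BK6 _⊕_ → BK0 _⊕_
BK6⇒BK0 _⊕_ bk6 P₁ P₂ R P₂⊢R = bk6 P₁ P₂ (P₂ ++ R) (⊢P⇒≡N₂-++ P₂ R P₂⊢R)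

BK0⇒BK6 : ∀ _⊕_ → RespectsSetEq _⊕_ → BK0 _⊕_ → BK6 _⊕_
BK0⇒BK6 _⊕_ resp bk0 P P₁ P₂ (P₁⊢P₂ , P₂⊢P₁) =
  SameAnswerSets-trans (bk0 P P₁ P₂ P₁⊢P₂)
    (SameAnswerSets-trans
      (≈P⇒SameAnswerSets (resp P P (P₁ ++ P₂) (P₂ ++ P₁) (≈P-refl P) (++-comm-≈P P₁ P₂)))
      (SameAnswerSets-sym (bk0 P P₂ P₁ P₂⊢P₁)))

theorem3p1 : (_⊕_ : Program → Program → Program) → RespectsSetEq _⊕_
    → (BK6 _⊕_ → BK0 _⊕_) × (BK0 _⊕_ → BK6 _⊕_)
theorem3p1 _⊕_ resp = BK6⇒BK0 _⊕_ , BK0⇒BK6 _⊕_ resp
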